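{- Let $G$ be a finite graph. If $b(H)=\psi(H)$ for every induced subgraph $H$ of $G$, or if $B(H)=\psi(H)$ for every induced subgraph $H$ of $G$, then $\omega(H)=\chi(H)$ for every induced subgraph $H$ of $G$.
   Context: All graphs are finite and simple. A $k$-coloring of $G$ is a surjective map $\varsigma\colon V(G)\to\{1,\dots,k\}$; it is proper if adjacent vertices get different colors; it is complete if for every pair of distinct colors $i,j$ there is an edge $xy$ with $\varsigma(x)=i$, $\varsigma(y)=j$; it is dominating if every color class contains a vertex having a neighbor in every other color class. The pseudoachromatic number $\psi(G)$ is the largest $k$ with a complete $k$-coloring; the pseudo-$b$-chromatic number $B(G)$ is the largest $k$ with a dominating $k$-coloring; the $b$-chromatic number $b(G)$ is the largest $k$ with a proper dominating $k$-coloring. $\omega(G)$ is the clique number and $\chi(G)$ the chromatic number. -}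

module Defs where

open import Data.Nat using (ℕ; _≤_)
open import Data.Fin using (Fin)
open import Data.Product using (Σ; ∃; _×_; _,_)
open import Relation.Nullary using (¬_; Dec)
open import Relation.Binary.PropositionalEquality using (_≡_; _≢_)
open import Function.Definitions using (Injective)
open import Function.Bundles using (_⇔_)

record Graph (n : ℕ) : Set₁ where
  field
    Adj    : Fin n → Fin n → Set
    sym    : ∀ {x y} → Adj x y → Adj y x
    irrefl : ∀ x → ¬ Adj x x
    adj?   : ∀ x y → Dec (Adj x y)
open Graph public

InducedSubgraph : ∀ {m n} → Graph m → Graph n → Set
InducedSubgraph {m} {n} H G =
  Σ (Fin m → Fin n) λ f →
    Injective _≡_ _≡_ f × (∀ x y → Adj H x y ⇔ Adj G (f x) (f y))

Surjective' : ∀ {n k} → (Fin n → Fin k) → Set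
Surjective' {n} {k} c = ∀ (i : Fin k) → ∃ λ v → c v ≡ i

module _ {n : ℕ} (G : Graph n) {k : ℕ} (c : Fin n → Fin k) where
  Proper : Set
  Proper = ∀ x y → Adj G x y → c x ≢ c y

  Complete : Set
  Complete = ∀ (i j : Fin k) → i ≢ j →
    ∃ λ x → ∃ λ y → Adj G x y × c x ≡ i × c y ≡ j

  Dominating : Set
  Dominating = ∀ (i : Fin k) → ∃ λ x → c x ≡ i ×
    (∀ (j : Fin k) → j ≢ i → ∃ λ y → Adj G x y × c y ≡ j)

module _ {n : ℕ} (G : Graph n) where
  HasCompleteColoring : ℕ → Set
  HasCompleteColoring k = Σ (Fin n → Fin k) λ c → Surjective' c × Complete G c

  HasDominatingColoring : ℕ → Set
  HasDominatingColoring k = Σ (Fin n → Fin k) λ c → Surjective' c × Dominating G c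

  HasBColoring : ℕ → Set
  HasBColoring k = Σ (Fin n → Fin k) λ c → Surjective' c × Proper G c × Dominating G c

  HasProperColoring : ℕ → Set
  HasProperColoring k = Σ (Fin n → Fin k) λ c → Surjective' c × Proper G c

  HasClique : ℕ → Set
  HasClique k = Σ (Fin k → Fin n) λ f →
    Injective _≡_ _≡_ f × (∀ i j → i ≢ j → Adj G (f i) (f j))

IsMax : (ℕ → Set) → ℕ → Set
IsMax P k = P k × (∀ j → P j → j ≤ k)

IsMin : (ℕ → Set) → ℕ → Set
IsMin P k = P k × (∀ j → P j → k ≤ j)

module _ {n : ℕ} (G : Graph n) where
  IsPseudoachromatic : ℕ → Set
  IsPseudoachromatic = IsMax (HasCompleteColoring G)

  IsPseudoBChromatic : ℕ → Set
  IsPseudoBChromatic = IsMax (HasDominatingColoring G)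

  IsBChromatic : ℕ → Set
  IsBChromatic = IsMax (HasBColoring G)

  IsChromatic : ℕ → Set
  IsChromatic = IsMin (HasProperColoring G)

  IsCliqueNumber : ℕ → Set
  IsCliqueNumber = IsMax (HasClique G)

  b≡ψ : Set
  b≡ψ = ∃ λ k → IsBChromatic k × IsPseudoachromatic k

  B≡ψ : Set
  B≡ψ = ∃ λ k → IsPseudoBChromatic k × IsPseudoachromatic k

  ω≡χ : Set
  ω≡χ = ∃ λ k → IsCliqueNumber k × IsChromatic k

module Submission where

-- Both hypotheses say that every induced subgraph H has a dominating
-- colouring with ψ(H) colours ('DominatingAtψ').  The proof has two halves.
--
-- A graph on four vertices containing the path 0–1–2–3
--    but with 0 ≁ 2 and 1 ≁ 3 (an induced P₄ or C₄) has a complete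
--    3-colouring, yet no dominating colouring with three or more colours,
--    since its edges all cross the bipartition {0,2} | {1,3}.  Hence a
--    graph all of whose induced subgraphs are 'DominatingAtψ' has no
--    induced P₄ or C₄.
--
-- In a graph without induced P₄ and C₄ the closed
--    neighbourhoods of adjacent vertices are nested.  Ordering vertices by
--    decreasing degree, colour each vertex by its number of earlier
--    neighbours: this colouring is proper, and a vertex of largest colour
--    together with its earlier neighbours is a clique of the same size,
--    so ω = χ.

open import Defs
open import Data.Nat using (ℕ)
open import Data.Sum using (_⊎_)

open import Data.Nat using (zero; suc; _≤_; _<_; s≤s; _≤?_; _<?_)
import Data.Nat as ℕ
open import Data.Nat.Properties
  using (<⇒≤; ≤-refl; ≤-trans; ≰⇒≥; <-trans; <⇒≱; <-irrefl; <-cmp; m≤n⇒m≤1+n)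
open import Data.Fin using (Fin; zero; suc; toℕ; fromℕ<; punchOut)
open import Data.Fin.Properties
  using (_≟_; toℕ-injective; toℕ-fromℕ<; injective⇒≤; punchOut-injective; any?)
open import Data.Bool using (Bool; true; false; not)
open import Data.Bool.Properties using (¬-not)
open import Data.Sum using (inj₁; inj₂)
import Data.Sum as Sum
open import Data.Product using (∃; _×_; _,_; proj₁; proj₂)
open import Data.Empty using (⊥; ⊥-elim)
open import Data.List using (List; _∷_; length; filter; allFin; lookup)
open import Data.List.Relation.Unary.All using (All; _∷_)
import Data.List.Relation.Unary.All as All
open import Data.List.Relation.Unary.All.Properties using (all-filter)
open import Data.List.Relation.Unary.Any using (here; there)
open import Data.List.Membership.Propositional using (_∈_)
open import Data.List.Membership.Propositional.Properties using (∈-allFin; ∈-lookup)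
open import Data.List.Relation.Binary.Sublist.Propositional using (⊆-refl)
open import Data.List.Relation.Binary.Sublist.Propositional.Properties
  using (filter⁺; length-mono-≤)
open import Data.List.Relation.Unary.Unique.Propositional using (Unique)
import Data.List.Relation.Unary.Unique.Propositional.Properties as Unique
open import Data.List.Relation.Unary.AllPairs using (_∷_)
import Data.Vec as Vec
import Data.Vec.Relation.Unary.AllPairs as VecAllPairs
import Data.Vec.Relation.Unary.All as VecAll
open import Data.Vec.Relation.Unary.Unique.Propositional using () renaming (Unique to VecUnique)
open import Data.Vec.Relation.Unary.Unique.Propositional.Properties
  using () renaming (lookup-injective to vec-lookup-injective)
open import Relation.Nullary using (¬_; Dec; yes; no)
open import Relation.Nullary.Decidable using (_×-dec_; _⊎-dec_)
open import Relation.Unary using (Decidable)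
open import Relation.Binary.PropositionalEquality
  using (_≡_; _≢_; refl; cong; subst; module ≡-Reasoning) renaming (sym to ≡-sym; trans to ≡-trans)
open import Relation.Binary using (tri<; tri≈; tri>)
open import Function using (_∘_; id)
open import Function.Bundles using (mk⇔; Equivalence)
open import Function.Definitions using (Injective)

module _ {A : Set} {P Q : A → Set} (P? : Decidable P) (Q? : Decidable Q)
         (P⇒Q : ∀ {x} → P x → Q x) where

  count-mono : ∀ xs → length (filter P? xs) ≤ length (filter Q? xs)
  count-mono xs = length-mono-≤ (filter⁺ P? Q? (λ { refl → P⇒Q }) (⊆-refl {x = xs}))

  count-strict : ∀ {x} xs → x ∈ xs → Q x → ¬ P x →
                 length (filter P? xs) < length (filter Q? xs)
  count-strict (y ∷ xs) (here refl) q ¬p with P? y | Q? y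
  ... | yes p | _     = ⊥-elim (¬p p)
  ... | no _  | yes _ = s≤s (count-mono xs)
  ... | no _  | no ¬q = ⊥-elim (¬q q)
  count-strict (y ∷ xs) (there x∈xs) q ¬p with P? y | Q? y
  ... | yes _ | yes _ = s≤s (count-strict xs x∈xs q ¬p)
  ... | yes p | no ¬q = ⊥-elim (¬q (P⇒Q p))
  ... | no _  | yes _ = m≤n⇒m≤1+n (count-strict xs x∈xs q ¬p)
  ... | no _  | no _  = count-strict xs x∈xs q ¬p

unique-lookup-injective : ∀ {A : Set} {xs : List A} → Unique xs →
                          ∀ i j → lookup xs i ≡ lookup xs j → i ≡ j
unique-lookup-injective (_ ∷ _) zero zero _ = refl
unique-lookup-injective (x∉ ∷ _) zero (suc j) e = ⊥-elim (All.lookup x∉ (∈-lookup j) e)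
unique-lookup-injective (x∉ ∷ _) (suc i) zero e = ⊥-elim (All.lookup x∉ (∈-lookup i) (≡-sym e))
unique-lookup-injective (_ ∷ u) (suc i) (suc j) e = cong suc (unique-lookup-injective u i j e)

injective⇒surjective : ∀ {k} (f : Fin k → Fin k) → Injective _≡_ _≡_ f →
                       ∀ t → ∃ λ i → f i ≡ t
injective⇒surjective {zero} f inj ()
injective⇒surjective {suc k} f inj t with any? (λ i → f i ≟ t)
... | yes hit = hit
... | no miss = ⊥-elim (<⇒≱ ≤-refl (injective⇒≤ {f = avoid} avoid-injective))
  where
  t∉image : ∀ i → t ≢ f i
  t∉image i e = miss (i , ≡-sym e)
  -- f misses t, so it factors through the k-element set Fin (suc k) ∖ {t}
  avoid : Fin (suc k) → Fin k
  avoid i = punchOut (t∉image i)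
  avoid-injective : Injective _≡_ _≡_ avoid
  avoid-injective {i} {j} e = inj (punchOut-injective (t∉image i) (t∉image j) e)

maximum-attained : ∀ {n} (f : Fin (suc n) → ℕ) → ∃ λ v → ∀ u → f u ≤ f v
maximum-attained {zero}  f = zero , λ { zero → ≤-refl }
maximum-attained {suc n} f with maximum-attained (f ∘ suc)
... | v , max-of-rest with f zero ≤? f (suc v)
...   | yes f0≤ = suc v , λ { zero → f0≤ ; (suc u) → max-of-rest u }
...   | no  f0≰ = zero , λ { zero → ≤-refl ; (suc u) → ≤-trans (max-of-rest u) (≰⇒≥ f0≰) }

induce : ∀ {n k} → Graph n → (Fin k → Fin n) → Graph k
induce G f = record
  { Adj    = λ a b → Adj G (f a) (f b)
  ; sym    = sym G
  ; irrefl = λ a → irrefl G (f a)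
  ; adj?   = λ a b → adj? G (f a) (f b)
  }

induce-induced : ∀ {n k} (G : Graph n) (f : Fin k → Fin n) → Injective _≡_ _≡_ f →
                 InducedSubgraph (induce G f) G
induce-induced G f f-inj = f , f-inj , λ a b → mk⇔ id id

induced-trans : ∀ {k m n} {K : Graph k} {H : Graph m} {G : Graph n} →
                InducedSubgraph K H → InducedSubgraph H G → InducedSubgraph K G
induced-trans (f , f-inj , f-iff) (g , g-inj , g-iff) =
  g ∘ f , f-inj ∘ g-inj ,
  λ a b → mk⇔ (Equivalence.to (g-iff (f a) (f b)) ∘ Equivalence.to (f-iff a b))
              (Equivalence.from (f-iff a b) ∘ Equivalence.from (g-iff (f a) (f b)))

adjacent⇒distinct : ∀ {n} (G : Graph n) {x y} → Adj G x y → x ≢ y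
adjacent⇒distinct G {x} a refl = irrefl G x a

module _ {m : ℕ} (H : Graph m) where

  proper-on-clique : ∀ {k j} (c : Fin m → Fin k) → Proper H c → (f : Fin j → Fin m) →
                     (∀ i i' → i ≢ i' → Adj H (f i) (f i')) → Injective _≡_ _≡_ (c ∘ f)
  proper-on-clique c c-proper f clique {i} {i'} e with i ≟ i'
  ... | yes i≡i' = i≡i'
  ... | no  i≢i' = ⊥-elim (c-proper (f i) (f i') (clique i i' i≢i') e)

  -- A k-clique and a proper colouring with at most k colours force ω = χ = k;
  -- the colouring uses all k colours because it is injective on the clique.
  clique+colouring⇒ω≡χ : ∀ k (c : Fin m → Fin k) → Proper H c → HasClique H k → ω≡χ H
  clique+colouring⇒ω≡χ k c c-proper (f , f-inj , clique) =
    k , ((f , f-inj , clique) , clique-bound) , ((c , c-onto , c-proper) , colour-bound)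
    where
    clique-bound : ∀ j → HasClique H j → j ≤ k
    clique-bound j (g , _ , g-clique) = injective⇒≤ (proper-on-clique c c-proper g g-clique)
    colour-bound : ∀ j → HasProperColoring H j → k ≤ j
    colour-bound j (d , _ , d-proper) = injective⇒≤ (proper-on-clique d d-proper f clique)
    c-onto : Surjective' c
    c-onto t with injective⇒surjective (c ∘ f) (proper-on-clique c c-proper f clique) t
    ... | i , e = f i , e

-- No path z – x – y – w with z, y distinct and non-adjacent and x, w
-- distinct and non-adjacent; i.e. no induced P₄ (z ≁ w) or C₄ (z ∼ w).
P₄C₄-free : ∀ {m} → Graph m → Set
P₄C₄-free H = ∀ z x y w → Adj H z x → Adj H x y → Adj H y w →
  ¬ Adj H z y → ¬ Adj H x w → z ≢ y → x ≢ w → ⊥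

-- The greedy colouring of a nonempty P₄C₄-free graph; nonemptiness provides
-- a vertex of largest colour.
module Greedy {m′ : ℕ} (H : Graph (suc m′)) (free : P₄C₄-free H) where
  m : ℕ
  m = suc m′

  N[_] : Fin m → Fin m → Set
  N[ x ] z = z ≡ x ⊎ Adj H x z

  N? : ∀ x → Decidable N[ x ]
  N? x z = (z ≟ x) ⊎-dec adj? H x z

  deg : Fin m → ℕ
  deg x = length (filter (N? x) (allFin m))

  -- Closed neighbourhoods of adjacent vertices are nested: if u ∼ v, a
  -- neighbour z of v outside N[u] would make N[u] ⊆ N[v] (any neighbour
  -- w of u outside N[v] would give the path w – u – v – z), so v would
  -- have strictly larger degree.
  nested : ∀ {u v} → deg v ≤ deg u → Adj H u v → ∀ z → Adj H v z → z ≢ u → Adj H u z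
  nested {u} {v} deg≤ u∼v z v∼z z≢u with adj? H u z
  ... | yes u∼z = u∼z
  ... | no  u≁z = ⊥-elim (<⇒≱ deg< deg≤)
    where
    z∉N[u] : ¬ N[ u ] z
    z∉N[u] (inj₁ z≡u) = z≢u z≡u
    z∉N[u] (inj₂ u∼z) = u≁z u∼z
    N[u]⊆N[v] : ∀ {w} → N[ u ] w → N[ v ] w
    N[u]⊆N[v] (inj₁ refl) = inj₂ (sym H u∼v)
    N[u]⊆N[v] {w} (inj₂ u∼w) with w ≟ v | adj? H v w
    ... | yes w≡v | _       = inj₁ w≡v
    ... | no  _   | yes v∼w = inj₂ v∼w
    ... | no  w≢v | no  v≁w =
      ⊥-elim (free w u v z (sym H u∼w) u∼v v∼z (v≁w ∘ sym H) u≁z w≢v (z≢u ∘ ≡-sym))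
    deg< : deg u < deg v
    deg< = count-strict (N? u) (N? v) N[u]⊆N[v] (allFin m) (∈-allFin z) (inj₂ v∼z) z∉N[u]

  _≺_ : Fin m → Fin m → Set
  u ≺ v = deg v < deg u ⊎ (deg u ≡ deg v × toℕ u < toℕ v)

  ≺? : ∀ u v → Dec (u ≺ v)
  ≺? u v = (deg v <? deg u) ⊎-dec ((deg u ℕ.≟ deg v) ×-dec (toℕ u <? toℕ v))

  ≺-irrefl : ∀ {u} → ¬ u ≺ u
  ≺-irrefl (inj₁ d<d)      = <-irrefl refl d<d
  ≺-irrefl (inj₂ (_ , i<i)) = <-irrefl refl i<i

  ≺-trans : ∀ {u v w} → u ≺ v → v ≺ w → u ≺ w
  ≺-trans (inj₁ a)       (inj₁ b)        = inj₁ (<-trans b a)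
  ≺-trans (inj₁ a)       (inj₂ (e , _))  = inj₁ (subst (_< _) e a)
  ≺-trans (inj₂ (e , _)) (inj₁ b)        = inj₁ (subst (_ <_) (≡-sym e) b)
  ≺-trans (inj₂ (e , a)) (inj₂ (e′ , b)) = inj₂ (≡-trans e e′ , <-trans a b)

  ≺-connex : ∀ u v → u ≢ v → u ≺ v ⊎ v ≺ u
  ≺-connex u v u≢v with <-cmp (deg u) (deg v)
  ... | tri< d< _ _ = inj₂ (inj₁ d<)
  ... | tri> _ _ d> = inj₁ (inj₁ d>)
  ... | tri≈ _ d≡ _ with <-cmp (toℕ u) (toℕ v)
  ...   | tri< i< _ _ = inj₁ (inj₂ (d≡ , i<))
  ...   | tri≈ _ i≡ _ = ⊥-elim (u≢v (toℕ-injective i≡))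
  ...   | tri> _ _ i> = inj₂ (inj₂ (≡-sym d≡ , i>))

  ≺⇒deg≥ : ∀ {u v} → u ≺ v → deg v ≤ deg u
  ≺⇒deg≥ (inj₁ d<)      = <⇒≤ d<
  ≺⇒deg≥ (inj₂ (d≡ , _)) = subst (_≤ _) d≡ ≤-refl

  Earlier : Fin m → Fin m → Set
  Earlier v w = w ≺ v × Adj H w v

  Earlier? : ∀ v → Decidable (Earlier v)
  Earlier? v w = ≺? w v ×-dec adj? H w v

  earlier : Fin m → List (Fin m)
  earlier v = filter (Earlier? v) (allFin m)

  col : Fin m → ℕ
  col v = length (earlier v)

  -- Along an edge u ∼ v with u ≺ v, every earlier neighbour of u is an
  -- earlier neighbour of v (by nesting), and u itself is one too.
  col-increasing : ∀ {u v} → u ≺ v → Adj H u v → col u < col v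
  col-increasing {u} {v} u≺v u∼v =
    count-strict (Earlier? u) (Earlier? v) inherit (allFin m) (∈-allFin u)
      (u≺v , u∼v) (≺-irrefl ∘ proj₁)
    where
    inherit : ∀ {w} → Earlier u w → Earlier v w
    inherit {w} (w≺u , w∼u) = w≺v , nested (≺⇒deg≥ w≺u) w∼u v u∼v v≢w
      where
      w≺v : w ≺ v
      w≺v = ≺-trans w≺u u≺v
      v≢w : v ≢ w
      v≢w refl = ≺-irrefl w≺v

  top : Fin m
  top = proj₁ (maximum-attained col)

  col≤top : ∀ u → col u ≤ col top
  col≤top = proj₂ (maximum-attained col)

  k : ℕ
  k = suc (col top)

  colour : Fin m → Fin k
  colour v = fromℕ< (s≤s (col≤top v))

  toℕ-colour : ∀ v → toℕ (colour v) ≡ col v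
  toℕ-colour v = toℕ-fromℕ< (s≤s (col≤top v))

  same-colour⇒same-col : ∀ {x y} → colour x ≡ colour y → col x ≡ col y
  same-colour⇒same-col {x} {y} same = begin
    col x            ≡⟨ toℕ-colour x ⟨
    toℕ (colour x)   ≡⟨ cong toℕ same ⟩
    toℕ (colour y)   ≡⟨ toℕ-colour y ⟩
    col y            ∎
    where open ≡-Reasoning

  -- adjacent vertices are ≺-comparable, and col strictly increases along ≺
  colour-proper : Proper H colour
  colour-proper x y x∼y same = by-order (≺-connex x y (adjacent⇒distinct H x∼y))
    where
    col-same : col x ≡ col y
    col-same = same-colour⇒same-col {x} {y} same
    by-order : x ≺ y ⊎ y ≺ x → ⊥
    by-order (inj₁ x≺y) = <-irrefl col-same (col-increasing {x} {y} x≺y x∼y)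
    by-order (inj₂ y≺x) = <-irrefl (≡-sym col-same) (col-increasing {y} {x} y≺x (sym H x∼y))

  cliqueList : List (Fin m)
  cliqueList = top ∷ earlier top

  InClique : Fin m → Set
  InClique p = p ≡ top ⊎ Earlier top p

  all-in-clique : All InClique cliqueList
  all-in-clique = inj₁ refl ∷ All.map inj₂ (all-filter (Earlier? top) (allFin m))

  cliqueList-unique : Unique cliqueList
  cliqueList-unique =
    All.map (λ { (p≺top , _) refl → ≺-irrefl p≺top }) (all-filter (Earlier? top) (allFin m))
    ∷ Unique.filter⁺ (Earlier? top) (Unique.allFin⁺ m)

  in-clique-adjacent : ∀ {p q} → InClique p → InClique q → p ≢ q → Adj H p q
  in-clique-adjacent (inj₁ refl)       (inj₁ refl)       p≢q = ⊥-elim (p≢q refl)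
  in-clique-adjacent (inj₁ refl)       (inj₂ (_ , q∼t))  _   = sym H q∼t
  in-clique-adjacent (inj₂ (_ , p∼t))  (inj₁ refl)       _   = p∼t
  in-clique-adjacent (inj₂ (p≺ , p∼t)) (inj₂ (_ , q∼t))  p≢q =
    nested (≺⇒deg≥ p≺) p∼t _ (sym H q∼t) (p≢q ∘ ≡-sym)

  clique : HasClique H k
  clique = lookup cliqueList , (λ {i} {j} → unique-lookup-injective cliqueList-unique i j) ,
    λ i j i≢j → in-clique-adjacent (member i) (member j)
                  (i≢j ∘ unique-lookup-injective cliqueList-unique i j)
    where
    member : ∀ i → InClique (lookup cliqueList i)
    member i = All.lookup all-in-clique (∈-lookup i)

  ω≡χ-holds : ω≡χ H
  ω≡χ-holds = clique+colouring⇒ω≡χ H k colour colour-proper clique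

P₄C₄-free⇒ω≡χ : ∀ {m} (H : Graph m) → P₄C₄-free H → ω≡χ H
P₄C₄-free⇒ω≡χ {zero}  H _    = clique+colouring⇒ω≡χ H 0 (λ ()) (λ ()) ((λ ()) , (λ { {()} }) , (λ ()))
P₄C₄-free⇒ω≡χ {suc _} H free = Greedy.ω≡χ-holds H free

DominatingAtψ : ∀ {m} → Graph m → Set
DominatingAtψ H = ∃ λ k → HasDominatingColoring H k × IsPseudoachromatic H k

b≡ψ⇒DominatingAtψ : ∀ {m} (H : Graph m) → b≡ψ H → DominatingAtψ H
b≡ψ⇒DominatingAtψ H (k , ((c , onto , _ , dom) , _) , ψ≡k) = k , (c , onto , dom) , ψ≡k

B≡ψ⇒DominatingAtψ : ∀ {m} (H : Graph m) → B≡ψ H → DominatingAtψ H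
B≡ψ⇒DominatingAtψ H (k , (dominating , _) , ψ≡k) = k , dominating , ψ≡k

-- Fin 4 as the bipartition {0,2} | {1,3} of the 4-cycle 0123.
side : Fin 4 → Bool
side zero                   = true
side (suc zero)             = false
side (suc (suc zero))       = true
side (suc (suc (suc zero))) = false

onSide₁ onSide₂ : Bool → Fin 4
onSide₁ true  = zero
onSide₁ false = suc zero
onSide₂ true  = suc (suc zero)
onSide₂ false = suc (suc (suc zero))

on-side : ∀ {b} u → side u ≡ b → u ≡ onSide₁ b ⊎ u ≡ onSide₂ b
on-side zero                   refl = inj₁ refl
on-side (suc zero)             refl = inj₁ refl
on-side (suc (suc zero))       refl = inj₂ refl
on-side (suc (suc (suc zero))) refl = inj₂ refl

three-bools : (a b d : Bool) → a ≡ b ⊎ a ≡ d ⊎ b ≡ d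
three-bools true  true  _     = inj₁ refl
three-bools false false _     = inj₁ refl
three-bools true  false true  = inj₂ (inj₁ refl)
three-bools false true  false = inj₂ (inj₁ refl)
three-bools true  false false = inj₂ (inj₂ refl)
three-bools false true  true  = inj₂ (inj₂ refl)

three-in-two : ∀ {k} {i j l : Fin k} (s t : Fin k) → i ≢ j → i ≢ l → j ≢ l →
  (s ≡ i ⊎ t ≡ i) → (s ≡ j ⊎ t ≡ j) → (s ≡ l ⊎ t ≡ l) → ⊥
three-in-two s t i≢j i≢l j≢l (inj₁ a) (inj₁ b) _ = i≢j (≡-trans (≡-sym a) b)
three-in-two s t i≢j i≢l j≢l (inj₂ a) (inj₂ b) _ = i≢j (≡-trans (≡-sym a) b)
three-in-two s t i≢j i≢l j≢l (inj₁ a) _ (inj₁ c) = i≢l (≡-trans (≡-sym a) c)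
three-in-two s t i≢j i≢l j≢l (inj₂ a) _ (inj₂ c) = i≢l (≡-trans (≡-sym a) c)
three-in-two s t i≢j i≢l j≢l _ (inj₁ b) (inj₁ c) = j≢l (≡-trans (≡-sym b) c)
three-in-two s t i≢j i≢l j≢l _ (inj₂ b) (inj₂ c) = j≢l (≡-trans (≡-sym b) c)

-- A subgraph of the 4-cycle 0123 has no dominating colouring with three or
-- more colours: two of the dominating vertices for colours 0, 1, 2 lie on
-- the same side, and between them they need all three colours on the two
-- vertices of the other side.
module SubgraphOfC₄ (H : Graph 4) (0≁2 : ¬ Adj H zero (suc (suc zero)))
                    (1≁3 : ¬ Adj H (suc zero) (suc (suc (suc zero)))) where

  crosses : ∀ u v → Adj H u v → side u ≢ side v
  crosses zero                   zero                   a = ⊥-elim (irrefl H _ a)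
  crosses zero                   (suc (suc zero))       a = ⊥-elim (0≁2 a)
  crosses (suc zero)             (suc zero)             a = ⊥-elim (irrefl H _ a)
  crosses (suc zero)             (suc (suc (suc zero))) a = ⊥-elim (1≁3 a)
  crosses (suc (suc zero))       zero                   a = ⊥-elim (0≁2 (sym H a))
  crosses (suc (suc zero))       (suc (suc zero))       a = ⊥-elim (irrefl H _ a)
  crosses (suc (suc (suc zero))) (suc zero)             a = ⊥-elim (1≁3 (sym H a))
  crosses (suc (suc (suc zero))) (suc (suc (suc zero))) a = ⊥-elim (irrefl H _ a)
  crosses zero                   (suc zero)             a ()
  crosses zero                   (suc (suc (suc zero))) a ()
  crosses (suc zero)             zero                   a ()
  crosses (suc zero)             (suc (suc zero))       a ()
  crosses (suc (suc zero))       (suc zero)             a ()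
  crosses (suc (suc zero))       (suc (suc (suc zero))) a ()
  crosses (suc (suc (suc zero))) zero                   a ()
  crosses (suc (suc (suc zero))) (suc (suc zero))       a ()

  module _ {k : ℕ} (c : Fin 4 → Fin k) where

    DominatesAs : Fin 4 → Fin k → Set
    DominatesAs v i = c v ≡ i × (∀ j → j ≢ i → ∃ λ u → Adj H v u × c u ≡ j)

    -- all neighbours of v lie on the opposite side, so it carries every other colour
    opposite-side-colours : ∀ {v i} → DominatesAs v i → ∀ j → j ≢ i →
      c (onSide₁ (not (side v))) ≡ j ⊎ c (onSide₂ (not (side v))) ≡ j
    opposite-side-colours {v} (_ , dom) j j≢i with dom j j≢i
    ... | u , v∼u , cu≡j =
      Sum.map (recolour cu≡j) (recolour cu≡j) (on-side u (¬-not (crosses u v (sym H v∼u))))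
      where
      recolour : ∀ {w w′} → c w ≡ j → w ≡ w′ → c w′ ≡ j
      recolour cw≡j refl = cw≡j

    -- dominating vertices of colours i and j on the same side force i, j and
    -- a third colour l onto the two vertices of the other side
    same-side-clash : ∀ {va vb i j l} → i ≢ j → i ≢ l → j ≢ l →
      DominatesAs va i → DominatesAs vb j → side va ≡ side vb → ⊥
    same-side-clash {va} {i = i} i≢j i≢l j≢l da db same =
      three-in-two (c (onSide₁ b)) (c (onSide₂ b)) i≢j i≢l j≢l
        (subst (λ s → c (onSide₁ (not s)) ≡ i ⊎ c (onSide₂ (not s)) ≡ i) (≡-sym same)
          (opposite-side-colours db i i≢j))
        (opposite-side-colours da _ (i≢j ∘ ≡-sym))
        (opposite-side-colours da _ (i≢l ∘ ≡-sym))
      where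
      b : Bool
      b = not (side va)

  -- the dominating vertices of colours 0, 1, 2: two share a side
  no-dominating-3 : ∀ {k} → 3 ≤ k → (c : Fin 4 → Fin k) → Dominating H c → ⊥
  no-dominating-3 (s≤s (s≤s (s≤s _))) c dom
    with dom zero | dom (suc zero) | dom (suc (suc zero))
  ... | v₀ , d₀ | v₁ , d₁ | v₂ , d₂ with three-bools (side v₀) (side v₁) (side v₂)
  ... | inj₁ e        = same-side-clash c {l = suc (suc zero)} (λ ()) (λ ()) (λ ()) d₀ d₁ e
  ... | inj₂ (inj₁ e) = same-side-clash c {l = suc zero} (λ ()) (λ ()) (λ ()) d₀ d₂ e
  ... | inj₂ (inj₂ e) = same-side-clash c {l = zero} (λ ()) (λ ()) (λ ()) d₁ d₂ e

path-complete-3 : (H : Graph 4) → Adj H zero (suc zero) → Adj H (suc zero) (suc (suc zero)) →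
  Adj H (suc (suc zero)) (suc (suc (suc zero))) → HasCompleteColoring H 3
path-complete-3 H 0∼1 1∼2 2∼3 = colour , onto , complete
  where
  colour : Fin 4 → Fin 3
  colour zero                   = zero
  colour (suc zero)             = suc zero
  colour (suc (suc zero))       = suc (suc zero)
  colour (suc (suc (suc zero))) = zero
  onto : Surjective' colour
  onto zero             = zero , refl
  onto (suc zero)       = suc zero , refl
  onto (suc (suc zero)) = suc (suc zero) , refl
  complete : Complete H colour
  complete zero             zero             ne = ⊥-elim (ne refl)
  complete zero             (suc zero)       _  = _ , _ , 0∼1 , refl , refl
  complete zero             (suc (suc zero)) _  = _ , _ , sym H 2∼3 , refl , refl
  complete (suc zero)       zero             _  = _ , _ , sym H 0∼1 , refl , refl
  complete (suc zero)       (suc zero)       ne = ⊥-elim (ne refl)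
  complete (suc zero)       (suc (suc zero)) _  = _ , _ , 1∼2 , refl , refl
  complete (suc (suc zero)) zero             _  = _ , _ , 2∼3 , refl , refl
  complete (suc (suc zero)) (suc zero)       _  = _ , _ , sym H 1∼2 , refl , refl
  complete (suc (suc zero)) (suc (suc zero)) ne = ⊥-elim (ne refl)

-- An induced P₄ or C₄ is not DominatingAtψ: ψ ≥ 3 there, but no
-- dominating colouring has three colours.
P₄C₄-not-DominatingAtψ : (H : Graph 4) →
  Adj H zero (suc zero) → Adj H (suc zero) (suc (suc zero)) → Adj H (suc (suc zero)) (suc (suc (suc zero))) →
  ¬ Adj H zero (suc (suc zero)) → ¬ Adj H (suc zero) (suc (suc (suc zero))) → ¬ DominatingAtψ H
P₄C₄-not-DominatingAtψ H 0∼1 1∼2 2∼3 0≁2 1≁3 (k , (c , _ , dom) , (_ , ψ-max)) =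
  SubgraphOfC₄.no-dominating-3 H 0≁2 1≁3 (ψ-max 3 (path-complete-3 H 0∼1 1∼2 2∼3)) c dom

-- If every induced subgraph of H is DominatingAtψ, then H has no induced P₄
-- or C₄: the four vertices of one would induce such a subgraph.
hereditary-DominatingAtψ⇒P₄C₄-free : ∀ {m} (H : Graph m) →
  (∀ {k} (K : Graph k) → InducedSubgraph K H → DominatingAtψ K) → P₄C₄-free H
hereditary-DominatingAtψ⇒P₄C₄-free {m} H hereditary z x y w z∼x x∼y y∼w z≁y x≁w z≢y x≢w =
  P₄C₄-not-DominatingAtψ (induce H quad) z∼x x∼y y∼w z≁y x≁w
    (hereditary (induce H quad) (induce-induced H quad quad-injective))
  where
  vertices : Vec.Vec (Fin m) 4
  vertices = z Vec.∷ x Vec.∷ y Vec.∷ w Vec.∷ Vec.[]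
  quad : Fin 4 → Fin m
  quad = Vec.lookup vertices
  z≢w : z ≢ w
  z≢w refl = z≁y (sym H y∼w)
  quad-injective : Injective _≡_ _≡_ quad
  quad-injective {i} {j} = vec-lookup-injective distinct i j
    where
    distinct : VecUnique vertices
    distinct = (adjacent⇒distinct H z∼x VecAll.∷ z≢y VecAll.∷ z≢w VecAll.∷ VecAll.[])
      VecAllPairs.∷ (adjacent⇒distinct H x∼y VecAll.∷ x≢w VecAll.∷ VecAll.[])
      VecAllPairs.∷ (adjacent⇒distinct H y∼w VecAll.∷ VecAll.[])
      VecAllPairs.∷ VecAll.[] VecAllPairs.∷ VecAllPairs.[]

corollary6 : ∀ {n} (G : Graph n) →
    ((∀ {m} (H : Graph m) → InducedSubgraph H G → b≡ψ H)
    ⊎ (∀ {m} (H : Graph m) → InducedSubgraph H G → B≡ψ H)) →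
    ∀ {m} (H : Graph m) → InducedSubgraph H G → ω≡χ H
corollary6 G hypothesis H H⊆G =
  P₄C₄-free⇒ω≡χ H (hereditary-DominatingAtψ⇒P₄C₄-free H inherited)
  where
  dominating : ∀ {k} (K : Graph k) → InducedSubgraph K G → DominatingAtψ K
  dominating K K⊆G = Sum.[ (λ b≡ψ-everywhere → b≡ψ⇒DominatingAtψ K (b≡ψ-everywhere K K⊆G))
                          , (λ B≡ψ-everywhere → B≡ψ⇒DominatingAtψ K (B≡ψ-everywhere K K⊆G))
                          ] hypothesis
  inherited : ∀ {k} (K : Graph k) → InducedSubgraph K H → DominatingAtψ K
  inherited K K⊆H = dominating K (induced-trans {K = K} {H = H} {G = G} K⊆H H⊆G)
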